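{- Let $\mathcal{C}$ be a cocomplete category, $F:\mathcal{C}\to\mathcal{C}$ an endofunctor, and suppose there is a size $\kappa$ such that $F$ preserves colimits of all diagrams $\kappa\to\mathcal{C}$. Then free $F$-algebras exist, that is, the forgetful functor from the category of $F$-algebras to $\mathcal{C}$ has a left adjoint.
   Context: Work in constructive (intuitionistic) logic with nested universes $\mathbf{Set}=\mathbf{Set}_0\in\mathbf{Set}_1\in\cdots$. $\mathcal{C}$ is locally small with objects forming a set in $\mathbf{Set}_1$ and is cocomplete (given chosen colimits of all small diagrams). A small thin semi-category is a set $\kappa$ with a transitive relation $<$; a diagram $D:\kappa\to\mathcal{C}$ assigns objects $D_i$ and morphisms $D_{j,i}:D_j\to D_i$ for $j<i$ with $D_{j,i}\circ D_{k,j}=D_{k,i}$ for $k<j<i$. A size is such a $(\kappa,<)$ that is directed (given $0\in\kappa$ and binary $\vee$ with $i<i\vee j$, $j<i\vee j$) and well-founded (every $K\subseteq\kappa$ with $\forall i.(\forall j<i.\,j\in K)\Rightarrow i\in K$ equals $\kappa$). An $F$-algebra is a pair $(A,a:F(A)\to A)$; morphisms $h:(A,a)\to(B,b)$ satisfy $h\circ a=b\circ F(h)$. -}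

module Defs where

open import Level using (Level; 0ℓ) renaming (suc to lsuc)
open import Data.Product using (Σ; _×_; _,_; proj₁; proj₂)
open import Relation.Binary.PropositionalEquality using (_≡_)
open import Relation.Binary.Structures using (IsEquivalence)

record Category : Set₂ where
  infixr 9 _∘_
  infix  4 _≈_
  field
    Obj     : Set₁
    Hom     : Obj → Obj → Set
    _≈_     : ∀ {A B} → Hom A B → Hom A B → Set
    ≈-equiv : ∀ {A B} → IsEquivalence (_≈_ {A} {B})
    id      : ∀ {A} → Hom A A
    _∘_     : ∀ {A B C} → Hom B C → Hom A B → Hom A C
    ∘-resp-≈ : ∀ {A B C} {f f′ : Hom B C} {g g′ : Hom A B} →
               f ≈ f′ → g ≈ g′ → f ∘ g ≈ f′ ∘ g′
    identityˡ : ∀ {A B} {f : Hom A B} → id ∘ f ≈ f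
    identityʳ : ∀ {A B} {f : Hom A B} → f ∘ id ≈ f
    assoc     : ∀ {A B C D} {f : Hom A B} {g : Hom B C} {h : Hom C D} →
                (h ∘ g) ∘ f ≈ h ∘ (g ∘ f)

  module ≈ {A B : Obj} = IsEquivalence (≈-equiv {A} {B})

record SmallCategory : Set₁ where
  infixr 9 _∘_
  infix  4 _≈_
  field
    Obj     : Set
    Hom     : Obj → Obj → Set
    _≈_     : ∀ {A B} → Hom A B → Hom A B → Set
    ≈-equiv : ∀ {A B} → IsEquivalence (_≈_ {A} {B})
    id      : ∀ {A} → Hom A A
    _∘_     : ∀ {A B C} → Hom B C → Hom A B → Hom A C
    ∘-resp-≈ : ∀ {A B C} {f f′ : Hom B C} {g g′ : Hom A B} →
               f ≈ f′ → g ≈ g′ → f ∘ g ≈ f′ ∘ g′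
    identityˡ : ∀ {A B} {f : Hom A B} → id ∘ f ≈ f
    identityʳ : ∀ {A B} {f : Hom A B} → f ∘ id ≈ f
    assoc     : ∀ {A B C D} {f : Hom A B} {g : Hom B C} {h : Hom C D} →
                (h ∘ g) ∘ f ≈ h ∘ (g ∘ f)

module _ (𝒞 : Category) where
  open Category 𝒞

  record Diagram (J : SmallCategory) : Set₁ where
    module J = SmallCategory J
    field
      D₀ : J.Obj → Obj
      D₁ : ∀ {i j} → J.Hom i j → Hom (D₀ i) (D₀ j)
      D-resp : ∀ {i j} {f g : J.Hom i j} → f J.≈ g → D₁ f ≈ D₁ g
      D-id   : ∀ {i} → D₁ (J.id {i}) ≈ id
      D-comp : ∀ {i j k} {f : J.Hom i j} {g : J.Hom j k} →
               D₁ (g J.∘ f) ≈ D₁ g ∘ D₁ f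

  record Cocone {J : SmallCategory} (D : Diagram J) : Set₁ where
    open Diagram D
    field
      apex    : Obj
      leg     : ∀ i → Hom (D₀ i) apex
      commute : ∀ {i j} (f : J.Hom i j) → leg j ∘ D₁ f ≈ leg i

  IsColimit : {J : SmallCategory} {D : Diagram J} → Cocone D → Set₁
  IsColimit {J} {D} c =
    (c′ : Cocone D) →
    Σ (Hom (Cocone.apex c) (Cocone.apex c′)) λ u →
      (∀ i → u ∘ Cocone.leg c i ≈ Cocone.leg c′ i) ×
      (∀ (u′ : Hom (Cocone.apex c) (Cocone.apex c′)) →
         (∀ i → u′ ∘ Cocone.leg c i ≈ Cocone.leg c′ i) → u′ ≈ u)

  Cocomplete : Set₁
  Cocomplete = (J : SmallCategory) (D : Diagram J) →
               Σ (Cocone D) IsColimit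

record Size : Set₁ where
  infix 4 _<_
  field
    κ       : Set
    _<_     : κ → κ → Set
    <-prop  : ∀ {i j} (p q : i < j) → p ≡ q
    <-trans : ∀ {k j i} → k < j → j < i → k < i
    𝟘       : κ
    _∨_     : κ → κ → κ
    <-∨ˡ    : ∀ i j → i < (i ∨ j)
    <-∨ʳ    : ∀ i j → j < (i ∨ j)
    wf      : (K : κ → Set) →
              (∀ i → (∀ j → j < i → K j) → K i) → ∀ i → K i

module _ (𝒞 : Category) (S : Size) where
  open Category 𝒞
  open Size S

  -- Diagrams κ → 𝒞 on the thin semi-category (κ, <).
  record SizeDiagram : Set₁ where
    field
      D₀     : κ → Obj
      D₁     : ∀ {j i} → j < i → Hom (D₀ j) (D₀ i)
      D-comp : ∀ {k j i} (p : k < j) (q : j < i) →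
               D₁ q ∘ D₁ p ≈ D₁ (<-trans p q)

  record SizeCocone (D : SizeDiagram) : Set₁ where
    open SizeDiagram D
    field
      apex    : Obj
      leg     : ∀ i → Hom (D₀ i) apex
      commute : ∀ {j i} (p : j < i) → leg i ∘ D₁ p ≈ leg j

  IsSizeColimit : {D : SizeDiagram} → SizeCocone D → Set₁
  IsSizeColimit {D} c =
    (c′ : SizeCocone D) →
    Σ (Hom (SizeCocone.apex c) (SizeCocone.apex c′)) λ u →
      (∀ i → u ∘ SizeCocone.leg c i ≈ SizeCocone.leg c′ i) ×
      (∀ (u′ : Hom (SizeCocone.apex c) (SizeCocone.apex c′)) →
         (∀ i → u′ ∘ SizeCocone.leg c i ≈ SizeCocone.leg c′ i) → u′ ≈ u)

record Endofunctor (𝒞 : Category) : Set₁ where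
  open Category 𝒞
  field
    F₀ : Obj → Obj
    F₁ : ∀ {A B} → Hom A B → Hom (F₀ A) (F₀ B)
    F-resp : ∀ {A B} {f g : Hom A B} → f ≈ g → F₁ f ≈ F₁ g
    F-id   : ∀ {A} → F₁ (id {A}) ≈ id
    F-comp : ∀ {A B C} {f : Hom A B} {g : Hom B C} →
             F₁ (g ∘ f) ≈ F₁ g ∘ F₁ f

module _ {𝒞 : Category} (F : Endofunctor 𝒞) where
  open Category 𝒞
  open Endofunctor F

  mapSizeDiagram : {S : Size} → SizeDiagram 𝒞 S → SizeDiagram 𝒞 S
  mapSizeDiagram {S} D = record
    { D₀ = λ i → F₀ (D₀ i)
    ; D₁ = λ p → F₁ (D₁ p)
    ; D-comp = λ p q → ≈.trans (≈.sym F-comp) (F-resp (D-comp p q))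
    }
    where open SizeDiagram D

  mapSizeCocone : {S : Size} {D : SizeDiagram 𝒞 S} →
                  SizeCocone 𝒞 S D → SizeCocone 𝒞 S (mapSizeDiagram D)
  mapSizeCocone c = record
    { apex = F₀ apex
    ; leg = λ i → F₁ (leg i)
    ; commute = λ p → ≈.trans (≈.sym F-comp) (F-resp (commute p))
    }
    where open SizeCocone c

  PreservesSizeColimits : Size → Set₁
  PreservesSizeColimits S =
    (D : SizeDiagram 𝒞 S) (c : SizeCocone 𝒞 S D) →
    IsSizeColimit 𝒞 S c → IsSizeColimit 𝒞 S (mapSizeCocone c)

  record Algebra : Set₁ where
    field
      carrier   : Obj
      structure : Hom (F₀ carrier) carrier

  record AlgebraHom (A B : Algebra) : Set where
    open Algebra
    field
      hom     : Hom (carrier A) (carrier B)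
      hom-alg : hom ∘ structure A ≈ structure B ∘ F₁ hom

  -- A free F-algebra on X: a universal arrow from X to the forgetful
  -- functor Alg(F) → 𝒞.
  record FreeAlgebra (X : Obj) : Set₁ where
    open Algebra
    open AlgebraHom
    field
      algebra : Algebra
      η       : Hom X (carrier algebra)
      universal : (B : Algebra) (f : Hom X (carrier B)) →
        Σ (AlgebraHom algebra B) λ h →
          (hom h ∘ η ≈ f) ×
          (∀ (h′ : AlgebraHom algebra B) → hom h′ ∘ η ≈ f → hom h′ ≈ hom h)

{-# OPTIONS --safe #-}
-- The free algebra on X is the colimit of a transfinite tower indexed by the
-- size κ. By well-founded recursion, stage i is the colimit of X together with
-- the objects F(W_j) for j < i, linked by the maps F(w_{j,k}) between earlier
-- stages; the connecting maps w and their functoriality are built in the same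
-- recursion. Since F preserves the colimit W∞ of the tower, the maps
-- F(W_i) → W_{i+1} → W∞ induce a structure map α : F(W∞) → W∞. A map X → B
-- into an algebra (B, β) extends stage by stage to W∞, and any algebra map
-- agreeing with it on X agrees with it on every stage by well-founded induction.
module Submission where

open import Data.Empty using (⊥)
open import Data.Product using (_,_; proj₁; proj₂)
open import Induction.WellFounded using (Acc; acc; acc-inverse; WellFounded)
open import Level using (0ℓ)
open import Relation.Binary.Bundles using (Setoid)
open import Relation.Binary.PropositionalEquality using (cong)
import Relation.Binary.Reasoning.Setoid as SetoidReasoning
open import Defs

module MorphismReasoning (𝒞 : Category) where
  open Category 𝒞

  hom-setoid : Obj → Obj → Setoid 0ℓ 0ℓ
  hom-setoid A B = record { Carrier = Hom A B ; _≈_ = _≈_ ; isEquivalence = ≈-equiv }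

  module HomReasoning {A B : Obj} = SetoidReasoning (hom-setoid A B)

  infixr 4 _⟩∘⟨_

  _⟩∘⟨_ : ∀ {A B C} {f f′ : Hom B C} {g g′ : Hom A B} → f ≈ f′ → g ≈ g′ → f ∘ g ≈ f′ ∘ g′
  _⟩∘⟨_ = ∘-resp-≈

  refl⟩∘⟨_ : ∀ {A B C} {f : Hom B C} {g g′ : Hom A B} → g ≈ g′ → f ∘ g ≈ f ∘ g′
  refl⟩∘⟨ e = ∘-resp-≈ ≈.refl e

  _⟩∘⟨refl : ∀ {A B C} {f f′ : Hom B C} {g : Hom A B} → f ≈ f′ → f ∘ g ≈ f′ ∘ g
  e ⟩∘⟨refl = ∘-resp-≈ e ≈.refl

  pullʳ : ∀ {A B C D} {f : Hom A B} {g : Hom B C} {h : Hom A C} {k : Hom C D} →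
          g ∘ f ≈ h → (k ∘ g) ∘ f ≈ k ∘ h
  pullʳ e = ≈.trans assoc (refl⟩∘⟨ e)

  pullˡ : ∀ {A B C D} {f : Hom B C} {g : Hom C D} {h : Hom B D} {k : Hom A B} →
          g ∘ f ≈ h → g ∘ (f ∘ k) ≈ h ∘ k
  pullˡ e = ≈.trans (≈.sym assoc) (e ⟩∘⟨refl)

  pushʳ : ∀ {A B C D} {f : Hom A B} {g : Hom B C} {h : Hom A C} {k : Hom C D} →
          h ≈ g ∘ f → k ∘ h ≈ (k ∘ g) ∘ f
  pushʳ e = ≈.sym (pullʳ (≈.sym e))

module FunctorReasoning {𝒞 : Category} (F : Endofunctor 𝒞) where
  open Category 𝒞
  open Endofunctor F

  F₁-merge : ∀ {A B C} {f : Hom A B} {g : Hom B C} {h : Hom A C} →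
             g ∘ f ≈ h → F₁ g ∘ F₁ f ≈ F₁ h
  F₁-merge e = ≈.trans (≈.sym F-comp) (F-resp e)

module GraphColimits (𝒞 : Category) where
  open Category 𝒞
  open MorphismReasoning 𝒞

  record Graph : Set₁ where
    field
      V  : Set
      E  : V → V → Set
      G₀ : V → Obj
      G₁ : ∀ {u v} → E u v → Hom (G₀ u) (G₀ v)

  record GraphCocone (G : Graph) : Set₁ where
    open Graph G
    field
      apex    : Obj
      leg     : ∀ v → Hom (G₀ v) apex
      commute : ∀ {u v} (e : E u v) → leg v ∘ G₁ e ≈ leg u

  record GraphColimit (G : Graph) : Set₁ where
    open Graph G
    field
      cocone : GraphCocone G
    open GraphCocone cocone public
    field
      mediate        : (c : GraphCocone G) → Hom apex (GraphCocone.apex c)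
      mediate-leg    : (c : GraphCocone G) (v : V) →
                       mediate c ∘ leg v ≈ GraphCocone.leg c v
      mediate-unique : (c : GraphCocone G) (u : Hom apex (GraphCocone.apex c)) →
                       (∀ v → u ∘ leg v ≈ GraphCocone.leg c v) → u ≈ mediate c

    jointly-epic : ∀ {A} {u u′ : Hom apex A} → (∀ v → u ∘ leg v ≈ u′ ∘ leg v) → u ≈ u′
    jointly-epic {A} {u} {u′} u≈u′ =
      ≈.trans (mediate-unique c u u≈u′) (≈.sym (mediate-unique c u′ (λ _ → ≈.refl)))
      where
      c : GraphCocone G
      c = record { apex = A ; leg = λ v → u′ ∘ leg v ; commute = λ e → pullʳ (commute e) }

  module FreeCategory (G : Graph) where
    open Graph G

    infixr 5 _∷_ _++_

    data Path : V → V → Set where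
      []  : ∀ {u} → Path u u
      _∷_ : ∀ {u v w} → E u v → Path v w → Path u w

    _++_ : ∀ {u v w} → Path u v → Path v w → Path u w
    []      ++ q = q
    (e ∷ p) ++ q = e ∷ (p ++ q)

    ⟦_⟧ : ∀ {u v} → Path u v → Hom (G₀ u) (G₀ v)
    ⟦ [] ⟧    = id
    ⟦ e ∷ p ⟧ = ⟦ p ⟧ ∘ G₁ e

    ⟦++⟧ : ∀ {u v w} (p : Path u v) (q : Path v w) → ⟦ p ++ q ⟧ ≈ ⟦ q ⟧ ∘ ⟦ p ⟧
    ⟦++⟧ []      q = ≈.sym identityʳ
    ⟦++⟧ (e ∷ p) q = ≈.trans (⟦++⟧ p q ⟩∘⟨refl) assoc

    -- Paths are identified when they denote equal morphisms, so that ⟦_⟧ is a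
    -- functor out of this category by construction.
    pathCategory : SmallCategory
    pathCategory = record
      { Obj = V ; Hom = Path ; _≈_ = λ p q → ⟦ p ⟧ ≈ ⟦ q ⟧
      ; ≈-equiv = record { refl = ≈.refl ; sym = ≈.sym ; trans = ≈.trans }
      ; id = [] ; _∘_ = λ q p → p ++ q
      ; ∘-resp-≈ = λ {_} {_} {_} {q} {q′} {p} {p′} q≈q′ p≈p′ →
          ≈.trans (⟦++⟧ p q) (≈.trans (q≈q′ ⟩∘⟨ p≈p′) (≈.sym (⟦++⟧ p′ q′)))
      ; identityˡ = λ {_} {_} {p} → ≈.trans (⟦++⟧ p []) identityˡ
      ; identityʳ = ≈.refl
      ; assoc = λ {_} {_} {_} {_} {p} {q} {r} → ++-assoc p q r
      }
      where
      ++-assoc : ∀ {t u v w} (p : Path t u) (q : Path u v) (r : Path v w) →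
                 ⟦ p ++ q ++ r ⟧ ≈ ⟦ (p ++ q) ++ r ⟧
      ++-assoc p q r = begin
        ⟦ p ++ q ++ r ⟧         ≈⟨ ⟦++⟧ p (q ++ r) ⟩
        ⟦ q ++ r ⟧ ∘ ⟦ p ⟧      ≈⟨ ⟦++⟧ q r ⟩∘⟨refl ⟩
        (⟦ r ⟧ ∘ ⟦ q ⟧) ∘ ⟦ p ⟧ ≈⟨ pullʳ (≈.sym (⟦++⟧ p q)) ⟩
        ⟦ r ⟧ ∘ ⟦ p ++ q ⟧      ≈⟨ ⟦++⟧ (p ++ q) r ⟨
        ⟦ (p ++ q) ++ r ⟧       ∎
        where open HomReasoning

    pathDiagram : Diagram 𝒞 pathCategory
    pathDiagram = record
      { D₀ = G₀ ; D₁ = ⟦_⟧ ; D-resp = λ p≈q → p≈q ; D-id = ≈.refl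
      ; D-comp = λ {_} {_} {_} {p} {q} → ⟦++⟧ p q }

    pathCocone : GraphCocone G → Cocone 𝒞 pathDiagram
    pathCocone c = record { apex = apex ; leg = leg ; commute = commute-path }
      where
      open GraphCocone c
      commute-path : ∀ {u v} (p : Path u v) → leg v ∘ ⟦ p ⟧ ≈ leg u
      commute-path []      = identityʳ
      commute-path (e ∷ p) = ≈.trans (≈.sym assoc) (≈.trans (commute-path p ⟩∘⟨refl) (commute e))

    edgeCocone : Cocone 𝒞 pathDiagram → GraphCocone G
    edgeCocone c = record
      { apex = apex ; leg = leg
      ; commute = λ e → ≈.trans (refl⟩∘⟨ ≈.sym identityˡ) (commute (e ∷ [])) }
      where open Cocone c

  graphColimit : Cocomplete 𝒞 → (G : Graph) → GraphColimit G
  graphColimit cc G = record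
    { cocone         = edgeCocone colimit
    ; mediate        = λ c → proj₁ (isColimit (pathCocone c))
    ; mediate-leg    = λ c → proj₁ (proj₂ (isColimit (pathCocone c)))
    ; mediate-unique = λ c → proj₂ (proj₂ (isColimit (pathCocone c)))
    }
    where
    open FreeCategory G
    colimit   = proj₁ (cc pathCategory pathDiagram)
    isColimit = proj₂ (cc pathCategory pathDiagram)

module SizeColimits (𝒞 : Category) (S : Size) where
  open Category 𝒞
  open Size S
  open GraphColimits 𝒞

  sizeGraph : SizeDiagram 𝒞 S → Graph
  sizeGraph D = record { V = κ ; E = _<_ ; G₀ = D₀ ; G₁ = D₁ }
    where open SizeDiagram D

  toSizeCocone : {D : SizeDiagram 𝒞 S} → GraphCocone (sizeGraph D) → SizeCocone 𝒞 S D
  toSizeCocone c = record { apex = apex ; leg = leg ; commute = commute }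
    where open GraphCocone c

  fromSizeCocone : {D : SizeDiagram 𝒞 S} → SizeCocone 𝒞 S D → GraphCocone (sizeGraph D)
  fromSizeCocone c = record { apex = apex ; leg = leg ; commute = commute }
    where open SizeCocone c

  GraphColimit⇒IsSizeColimit : (D : SizeDiagram 𝒞 S) (L : GraphColimit (sizeGraph D)) →
                               IsSizeColimit 𝒞 S (toSizeCocone {D} (GraphColimit.cocone L))
  GraphColimit⇒IsSizeColimit D L c =
    mediate (fromSizeCocone c) , mediate-leg (fromSizeCocone c) , mediate-unique (fromSizeCocone c)
    where open GraphColimit L

  IsSizeColimit⇒GraphColimit : {D : SizeDiagram 𝒞 S} {c : SizeCocone 𝒞 S D} →
                               IsSizeColimit 𝒞 S c → GraphColimit (sizeGraph D)
  IsSizeColimit⇒GraphColimit {c = c} isColimit = record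
    { cocone         = fromSizeCocone c
    ; mediate        = λ c′ → proj₁ (isColimit (toSizeCocone c′))
    ; mediate-leg    = λ c′ → proj₁ (proj₂ (isColimit (toSizeCocone c′)))
    ; mediate-unique = λ c′ → proj₂ (proj₂ (isColimit (toSizeCocone c′)))
    }

module Tower (𝒞 : Category) (cc : Cocomplete 𝒞) (F : Endofunctor 𝒞)
             (S : Size) (X : Category.Obj 𝒞) where
  open Category 𝒞
  open Endofunctor F
  open Size S
  open MorphismReasoning 𝒞
  open FunctorReasoning F
  open GraphColimits 𝒞
  open GraphColimit

  infix 4 _≼_

  _≼_ : κ → κ → Set
  j ≼ k = ∀ {m} → m < j → m < k

  ≼-refl : ∀ {j} → j ≼ j
  ≼-refl p = p

  ≼-trans : ∀ {i j k} → i ≼ j → j ≼ k → i ≼ k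
  ≼-trans q₁ q₂ p = q₂ (q₁ p)

  <⇒≼ : ∀ {j i} → j < i → j ≼ i
  <⇒≼ p r = <-trans r p

  data Node (i : κ) : Set where
    base  : Node i
    layer : (j : κ) → j < i → Node i

  Edge : ∀ {i} → Node i → Node i → Set
  Edge (layer j _) (layer k _) = j ≼ k
  Edge _           _           = ⊥

  -- Everything is indexed by an accessibility proof rather than by an element
  -- of κ: this is what makes the recursion structural. Different proofs of the
  -- same index give isomorphic stages, via w a b ≼-refl.
  mutual
    stage : ∀ {i} → Acc _<_ i → Graph
    stage {i} a = record { V = Node i ; E = Edge ; G₀ = node a ; G₁ = edge a }

    node : ∀ {i} → Acc _<_ i → Node i → Obj
    node _        base        = X
    node (acc rs) (layer j p) = F₀ (W (rs p))

    edge : ∀ {i} (a : Acc _<_ i) {u v : Node i} → Edge u v → Hom (node a u) (node a v)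
    edge (acc rs) {layer j p} {layer k p′} q = F₁ (w (rs p) (rs p′) q)

    colim : ∀ {i} (a : Acc _<_ i) → GraphColimit (stage a)
    colim a = graphColimit cc (stage a)

    W : ∀ {i} → Acc _<_ i → Obj
    W a = apex (colim a)

    stage-leg : ∀ {i} (a : Acc _<_ i) (v : Node i) → Hom (node a v) (W a)
    stage-leg a = leg (colim a)

    shift-leg : ∀ {j k} (a : Acc _<_ j) (b : Acc _<_ k) → j ≼ k →
                (v : Node j) → Hom (node a v) (W b)
    shift-leg (acc rs) (acc ss) q base        = stage-leg (acc ss) base
    shift-leg (acc rs) (acc ss) q (layer m p) =
      stage-leg (acc ss) (layer m (q p)) ∘ F₁ (w (rs p) (ss (q p)) ≼-refl)

    shift-commute : ∀ {j k} (a : Acc _<_ j) (b : Acc _<_ k) (q : j ≼ k) {u v : Node j}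
                    (e : Edge u v) → shift-leg a b q v ∘ edge a e ≈ shift-leg a b q u
    shift-commute (acc rs) (acc ss) q {layer m p} {layer m′ p′} r = begin
      (stage-leg (acc ss) (layer m′ (q p′)) ∘ F₁ (w (rs p′) (ss (q p′)) ≼-refl)) ∘ F₁ (w (rs p) (rs p′) r)
        ≈⟨ pullʳ (F₁-merge (w-∘ (rs p) (rs p′) (ss (q p′)) r ≼-refl)) ⟩
      stage-leg (acc ss) (layer m′ (q p′)) ∘ F₁ (w (rs p) (ss (q p′)) r)
        ≈⟨ pushʳ (≈.sym (F₁-merge (w-∘ (rs p) (ss (q p)) (ss (q p′)) ≼-refl r))) ⟩
      (stage-leg (acc ss) (layer m′ (q p′)) ∘ F₁ (w (ss (q p)) (ss (q p′)) r)) ∘ F₁ (w (rs p) (ss (q p)) ≼-refl)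
        ≈⟨ commute (colim (acc ss)) {layer m (q p)} {layer m′ (q p′)} r ⟩∘⟨refl ⟩
      stage-leg (acc ss) (layer m (q p)) ∘ F₁ (w (rs p) (ss (q p)) ≼-refl)
        ∎
      where open HomReasoning

    shift : ∀ {j k} (a : Acc _<_ j) (b : Acc _<_ k) → j ≼ k → GraphCocone (stage a)
    shift a b q = record { apex = W b ; leg = shift-leg a b q ; commute = shift-commute a b q }

    w : ∀ {j k} (a : Acc _<_ j) (b : Acc _<_ k) → j ≼ k → Hom (W a) (W b)
    w a b q = mediate (colim a) (shift a b q)

    w-leg : ∀ {j k} (a : Acc _<_ j) (b : Acc _<_ k) (q : j ≼ k) (v : Node j) →
            w a b q ∘ stage-leg a v ≈ shift-leg a b q v
    w-leg a b q = mediate-leg (colim a) (shift a b q)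

    w-∘ : ∀ {i j k} (a : Acc _<_ i) (b : Acc _<_ j) (c : Acc _<_ k) (q₁ : i ≼ j) (q₂ : j ≼ k) →
          w b c q₂ ∘ w a b q₁ ≈ w a c (≼-trans q₁ q₂)
    w-∘ a b c q₁ q₂ = jointly-epic (colim a) (w-∘-leg a b c q₁ q₂)

    w-∘-leg : ∀ {i j k} (a : Acc _<_ i) (b : Acc _<_ j) (c : Acc _<_ k) (q₁ : i ≼ j) (q₂ : j ≼ k)
              (v : Node i) →
              (w b c q₂ ∘ w a b q₁) ∘ stage-leg a v ≈ w a c (≼-trans q₁ q₂) ∘ stage-leg a v
    w-∘-leg (acc rs) (acc ss) (acc ts) q₁ q₂ base =
      ≈.trans (pullʳ (w-leg (acc rs) (acc ss) q₁ base))
        (≈.trans (w-leg (acc ss) (acc ts) q₂ base)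
                 (≈.sym (w-leg (acc rs) (acc ts) (≼-trans q₁ q₂) base)))
    w-∘-leg (acc rs) (acc ss) (acc ts) q₁ q₂ (layer m p) = begin
      (w (acc ss) (acc ts) q₂ ∘ w (acc rs) (acc ss) q₁) ∘ stage-leg (acc rs) (layer m p)
        ≈⟨ pullʳ (w-leg (acc rs) (acc ss) q₁ (layer m p)) ⟩
      w (acc ss) (acc ts) q₂ ∘ (stage-leg (acc ss) (layer m (q₁ p)) ∘ F₁ (w (rs p) (ss (q₁ p)) ≼-refl))
        ≈⟨ pullˡ (w-leg (acc ss) (acc ts) q₂ (layer m (q₁ p))) ⟩
      (stage-leg (acc ts) (layer m (q₂ (q₁ p))) ∘ F₁ (w (ss (q₁ p)) (ts (q₂ (q₁ p))) ≼-refl))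
        ∘ F₁ (w (rs p) (ss (q₁ p)) ≼-refl)
        ≈⟨ pullʳ (F₁-merge (w-∘ (rs p) (ss (q₁ p)) (ts (q₂ (q₁ p))) ≼-refl ≼-refl)) ⟩
      stage-leg (acc ts) (layer m (q₂ (q₁ p))) ∘ F₁ (w (rs p) (ts (q₂ (q₁ p))) ≼-refl)
        ≈⟨ w-leg (acc rs) (acc ts) (≼-trans q₁ q₂) (layer m p) ⟨
      w (acc rs) (acc ts) (≼-trans q₁ q₂) ∘ stage-leg (acc rs) (layer m p)
        ∎
      where open HomReasoning

  η-stage : ∀ {i} (a : Acc _<_ i) → Hom X (W a)
  η-stage a = stage-leg a base

  α-stage : ∀ {i j} (a : Acc _<_ i) (p : j < i) → Hom (F₀ (W (acc-inverse a p))) (W a)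
  α-stage {j = j} (acc rs) p = stage-leg (acc rs) (layer j p)

  w-η : ∀ {j k} (a : Acc _<_ j) (b : Acc _<_ k) (q : j ≼ k) → w a b q ∘ η-stage a ≈ η-stage b
  w-η (acc rs) (acc ss) q = w-leg (acc rs) (acc ss) q base

  w-α : ∀ {j k m} (a : Acc _<_ j) (b : Acc _<_ k) (q : j ≼ k) (p : m < j) →
        w a b q ∘ α-stage a p ≈
        α-stage b (q p) ∘ F₁ (w (acc-inverse a p) (acc-inverse b (q p)) ≼-refl)
  w-α {m = m} (acc rs) (acc ss) q p = w-leg (acc rs) (acc ss) q (layer m p)

  α-stage-edge : ∀ {k j j′} (a : Acc _<_ k) (p : j < k) (p′ : j′ < k) (r : j ≼ j′) →
                 α-stage a p′ ∘ F₁ (w (acc-inverse a p) (acc-inverse a p′) r) ≈ α-stage a p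
  α-stage-edge {j = j} {j′} (acc rs) p p′ r = commute (colim (acc rs)) {layer j p} {layer j′ p′} r

  stage-jointly-epic : ∀ {i B} (a : Acc _<_ i) {u u′ : Hom (W a) B} →
    u ∘ η-stage a ≈ u′ ∘ η-stage a →
    (∀ {j} (p : j < i) → u ∘ α-stage a p ≈ u′ ∘ α-stage a p) → u ≈ u′
  stage-jointly-epic (acc rs) onη onα = jointly-epic (colim (acc rs)) λ
    { base        → onη
    ; (layer j p) → onα p }

  α-stage-absorb : ∀ {k j j′} (a : Acc _<_ k) (p : j < k) (p′ : j′ < k)
                   (b : Acc _<_ j) (r : j ≼ j′) →
                   α-stage a p′ ∘ F₁ (w b (acc-inverse a p′) r) ≈
                   α-stage a p ∘ F₁ (w b (acc-inverse a p) ≼-refl)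
  α-stage-absorb a p p′ b r =
    ≈.trans (refl⟩∘⟨ ≈.sym (F₁-merge (w-∘ b (acc-inverse a p) (acc-inverse a p′) ≼-refl r)))
            (pullˡ (α-stage-edge a p p′ r))

  w-id : ∀ {i} (a : Acc _<_ i) → w a a ≼-refl ≈ id
  w-id (acc rs) = stage-jointly-epic (acc rs)
    (≈.trans (w-η (acc rs) (acc rs) ≼-refl) (≈.sym identityˡ))
    λ p → begin
      w (acc rs) (acc rs) ≼-refl ∘ α-stage (acc rs) p  ≈⟨ w-α (acc rs) (acc rs) ≼-refl p ⟩
      α-stage (acc rs) p ∘ F₁ (w (rs p) (rs p) ≼-refl) ≈⟨ refl⟩∘⟨ ≈.trans (F-resp (w-id (rs p))) F-id ⟩
      α-stage (acc rs) p ∘ id                          ≈⟨ identityʳ ⟩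
      α-stage (acc rs) p                               ≈⟨ identityˡ ⟨
      id ∘ α-stage (acc rs) p                          ∎
    where open HomReasoning

  -- Proofs of j ≼ k are functions, so they can only be compared pointwise, via <-prop.
  w-irrelevant : ∀ {j k} (a : Acc _<_ j) (b : Acc _<_ k) (q q′ : j ≼ k) → w a b q ≈ w a b q′
  w-irrelevant {j} {k} a b q q′ = stage-jointly-epic a
    (≈.trans (w-η a b q) (≈.sym (w-η a b q′)))
    λ p → ≈.trans (w-α a b q p)
            (≈.trans (≈.reflexive (cong (α-stage-at p) (<-prop (q p) (q′ p))))
                     (≈.sym (w-α a b q′ p)))
    where
    α-stage-at : ∀ {m} (p : m < j) → m < k → Hom (F₀ (W (acc-inverse a p))) (W b)
    α-stage-at p x = α-stage b x ∘ F₁ (w (acc-inverse a p) (acc-inverse b x) ≼-refl)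

  accessible : WellFounded _<_
  accessible = wf (Acc _<_) (λ i rs → acc (λ {j} → rs j))

  chain : SizeDiagram 𝒞 S
  chain = record
    { D₀ = λ i → W (accessible i)
    ; D₁ = λ {j} {i} p → w (accessible j) (accessible i) (<⇒≼ p)
    ; D-comp = λ {k} {j} {i} p q →
        ≈.trans (w-∘ (accessible k) (accessible j) (accessible i) (<⇒≼ p) (<⇒≼ q))
                (w-irrelevant (accessible k) (accessible i) _ _)
    }

  module Fold (B : Algebra F) (f : Hom X (Algebra.carrier B)) where
    open Algebra B renaming (carrier to B₀; structure to β)

    mutual
      fold-cocone : ∀ {i} (a : Acc _<_ i) → GraphCocone (stage a)
      fold-cocone a = record { apex = B₀ ; leg = fold-leg a ; commute = fold-commute a }

      fold-leg : ∀ {i} (a : Acc _<_ i) (v : Node i) → Hom (node a v) B₀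
      fold-leg _        base        = f
      fold-leg (acc rs) (layer j p) = β ∘ F₁ (fold (rs p))

      fold-commute : ∀ {i} (a : Acc _<_ i) {u v : Node i} (e : Edge u v) →
                     fold-leg a v ∘ edge a e ≈ fold-leg a u
      fold-commute (acc rs) {layer j p} {layer k p′} r = pullʳ (F₁-merge (fold-w (rs p) (rs p′) r))

      fold : ∀ {i} (a : Acc _<_ i) → Hom (W a) B₀
      fold a = mediate (colim a) (fold-cocone a)

      fold-leg-eq : ∀ {i} (a : Acc _<_ i) (v : Node i) → fold a ∘ stage-leg a v ≈ fold-leg a v
      fold-leg-eq a = mediate-leg (colim a) (fold-cocone a)

      fold-w : ∀ {j k} (a : Acc _<_ j) (b : Acc _<_ k) (r : j ≼ k) → fold b ∘ w a b r ≈ fold a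
      fold-w a b r = jointly-epic (colim a) λ v →
        ≈.trans (fold-w-leg a b r v) (≈.sym (fold-leg-eq a v))

      fold-w-leg : ∀ {j k} (a : Acc _<_ j) (b : Acc _<_ k) (r : j ≼ k) (v : Node j) →
                   (fold b ∘ w a b r) ∘ stage-leg a v ≈ fold-leg a v
      fold-w-leg (acc rs) (acc ss) r base =
        ≈.trans (pullʳ (w-leg (acc rs) (acc ss) r base)) (fold-leg-eq (acc ss) base)
      fold-w-leg (acc rs) (acc ss) r (layer m p) = begin
        (fold (acc ss) ∘ w (acc rs) (acc ss) r) ∘ stage-leg (acc rs) (layer m p)
          ≈⟨ pullʳ (w-leg (acc rs) (acc ss) r (layer m p)) ⟩
        fold (acc ss) ∘ (stage-leg (acc ss) (layer m (r p)) ∘ F₁ (w (rs p) (ss (r p)) ≼-refl))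
          ≈⟨ pullˡ (fold-leg-eq (acc ss) (layer m (r p))) ⟩
        (β ∘ F₁ (fold (ss (r p)))) ∘ F₁ (w (rs p) (ss (r p)) ≼-refl)
          ≈⟨ pullʳ (F₁-merge (fold-w (rs p) (ss (r p)) ≼-refl)) ⟩
        β ∘ F₁ (fold (rs p))
          ∎
        where open HomReasoning

    fold-η : ∀ {i} (a : Acc _<_ i) → fold a ∘ η-stage a ≈ f
    fold-η a = fold-leg-eq a base

    fold-α : ∀ {i j} (a : Acc _<_ i) (p : j < i) →
             fold a ∘ α-stage a p ≈ β ∘ F₁ (fold (acc-inverse a p))
    fold-α {j = j} (acc rs) p = fold-leg-eq (acc rs) (layer j p)

module FreeAlgebraConstruction (𝒞 : Category) (cc : Cocomplete 𝒞) (F : Endofunctor 𝒞)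
                               (S : Size) (pres : PreservesSizeColimits F S)
                               (X : Category.Obj 𝒞) where
  open Category 𝒞
  open Endofunctor F
  open Size S
  open MorphismReasoning 𝒞
  open FunctorReasoning F
  open GraphColimits 𝒞
  open SizeColimits 𝒞 S
  open Tower 𝒞 cc F S X

  W∞-colimit : GraphColimit (sizeGraph chain)
  W∞-colimit = graphColimit cc (sizeGraph chain)

  FW∞-colimit : GraphColimit (sizeGraph (mapSizeDiagram F chain))
  FW∞-colimit = IsSizeColimit⇒GraphColimit {c = mapSizeCocone F W∞-cocone}
                  (pres chain W∞-cocone (GraphColimit⇒IsSizeColimit chain W∞-colimit))
    where
    W∞-cocone : SizeCocone 𝒞 S chain
    W∞-cocone = toSizeCocone (GraphColimit.cocone W∞-colimit)

  open GraphColimit W∞-colimit using () renaming (apex to W∞; leg to ι; commute to ι-commute)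

  enter : ∀ k {j} (p : j < k) (b : Acc _<_ j) → Hom (F₀ (W b)) W∞
  enter k p b = ι k ∘ (α-stage (accessible k) p ∘ F₁ (w b (acc-inverse (accessible k) p) ≼-refl))

  enter-up : ∀ {j k m} (k<m : k < m) (p : j < k) (b : Acc _<_ j) →
             enter k p b ≈ enter m (<-trans p k<m) b
  enter-up {j} {k} {m} k<m p b = begin
    ι k ∘ (α-stage (accessible k) p ∘ F₁ (w b s ≼-refl))
      ≈⟨ ι-commute k<m ⟩∘⟨refl ⟨
    (ι m ∘ w (accessible k) (accessible m) (<⇒≼ k<m)) ∘ (α-stage (accessible k) p ∘ F₁ (w b s ≼-refl))
      ≈⟨ assoc ⟩
    ι m ∘ (w (accessible k) (accessible m) (<⇒≼ k<m) ∘ (α-stage (accessible k) p ∘ F₁ (w b s ≼-refl)))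
      ≈⟨ refl⟩∘⟨ pullˡ (w-α (accessible k) (accessible m) (<⇒≼ k<m) p) ⟩
    ι m ∘ ((α-stage (accessible m) (<-trans p k<m) ∘ F₁ (w s s′ ≼-refl)) ∘ F₁ (w b s ≼-refl))
      ≈⟨ refl⟩∘⟨ pullʳ (F₁-merge (w-∘ b s s′ ≼-refl ≼-refl)) ⟩
    ι m ∘ (α-stage (accessible m) (<-trans p k<m) ∘ F₁ (w b s′ ≼-refl))
      ∎
    where
    open HomReasoning
    s  = acc-inverse (accessible k) p
    s′ = acc-inverse (accessible m) (<-trans p k<m)

  enter-irrelevant : ∀ {j} k k′ (p : j < k) (p′ : j < k′) (b : Acc _<_ j) →
                     enter k p b ≈ enter k′ p′ b
  enter-irrelevant k k′ p p′ b =
    ≈.trans (enter-up (<-∨ˡ k k′) p b)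
      (≈.trans (refl⟩∘⟨ α-stage-absorb (accessible (k ∨ k′)) (<-trans p′ (<-∨ʳ k k′)) _ b ≼-refl)
        (≈.sym (enter-up (<-∨ʳ k k′) p′ b)))

  enter-natural : ∀ k {i j} (q : i < k) (Q : j < k) (b : Acc _<_ i) (c : Acc _<_ j) (r : j ≼ i) →
                  enter k q b ∘ F₁ (w c b r) ≈ enter k Q c
  enter-natural k q Q b c r =
    ≈.trans (pullʳ (pullʳ (F₁-merge (w-∘ c b (acc-inverse (accessible k) q) r ≼-refl))))
            (refl⟩∘⟨ α-stage-absorb (accessible k) Q q c r)

  -- i ∨ i serves as a stage strictly above i.
  α-cocone : GraphCocone (sizeGraph (mapSizeDiagram F chain))
  α-cocone = record
    { apex    = W∞
    ; leg     = λ i → enter (i ∨ i) (<-∨ˡ i i) (accessible i)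
    ; commute = λ {j} {i} p →
        ≈.trans (enter-natural (i ∨ i) (<-∨ˡ i i) (<-trans p (<-∨ˡ i i))
                               (accessible i) (accessible j) (<⇒≼ p))
                (enter-irrelevant (i ∨ i) (j ∨ j) _ _ (accessible j))
    }

  α : Hom (F₀ W∞) W∞
  α = GraphColimit.mediate FW∞-colimit α-cocone

  η : Hom X W∞
  η = ι 𝟘 ∘ η-stage (accessible 𝟘)

  α-ι : ∀ i → α ∘ F₁ (ι i) ≈ enter (i ∨ i) (<-∨ˡ i i) (accessible i)
  α-ι = GraphColimit.mediate-leg FW∞-colimit α-cocone

  ι-η-stage : ∀ i → ι i ∘ η-stage (accessible i) ≈ η
  ι-η-stage i = ≈.trans (up (<-∨ˡ i 𝟘)) (≈.sym (up (<-∨ʳ i 𝟘)))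
    where
    up : ∀ {j k} → j < k → ι j ∘ η-stage (accessible j) ≈ ι k ∘ η-stage (accessible k)
    up {j} {k} j<k = ≈.trans (≈.sym (ι-commute j<k) ⟩∘⟨refl)
                             (pullʳ (w-η (accessible j) (accessible k) (<⇒≼ j<k)))

  ι-α-stage : ∀ i {j} (p : j < i) →
              ι i ∘ α-stage (accessible i) p ≈
              α ∘ F₁ (ι j ∘ w (acc-inverse (accessible i) p) (accessible j) ≼-refl)
  ι-α-stage i {j} p = ≈.sym (begin
    α ∘ F₁ (ι j ∘ w b (accessible j) ≼-refl)        ≈⟨ pushʳ F-comp ⟩
    (α ∘ F₁ (ι j)) ∘ F₁ (w b (accessible j) ≼-refl) ≈⟨ α-ι j ⟩∘⟨refl ⟩
    enter (j ∨ j) (<-∨ˡ j j) (accessible j) ∘ F₁ (w b (accessible j) ≼-refl)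
      ≈⟨ enter-natural (j ∨ j) (<-∨ˡ j j) (<-∨ˡ j j) (accessible j) b ≼-refl ⟩
    enter (j ∨ j) (<-∨ˡ j j) b                     ≈⟨ enter-irrelevant (j ∨ j) i (<-∨ˡ j j) p b ⟩
    ι i ∘ (α-stage (accessible i) p ∘ F₁ (w b b ≼-refl))
      ≈⟨ refl⟩∘⟨ (refl⟩∘⟨ ≈.trans (F-resp (w-id b)) F-id) ⟩
    ι i ∘ (α-stage (accessible i) p ∘ id)           ≈⟨ refl⟩∘⟨ identityʳ ⟩
    ι i ∘ α-stage (accessible i) p                  ∎)
    where
    open HomReasoning
    b = acc-inverse (accessible i) p

  module Universal (B : Algebra F) (f : Hom X (Algebra.carrier B)) where
    open Algebra B renaming (carrier to B₀; structure to β)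
    open Fold B f

    fold∞ : Hom W∞ B₀
    fold∞ = GraphColimit.mediate W∞-colimit record
      { apex = B₀ ; leg = λ i → fold (accessible i)
      ; commute = λ {j} {i} p → fold-w (accessible j) (accessible i) (<⇒≼ p) }

    fold∞-ι : ∀ i → fold∞ ∘ ι i ≈ fold (accessible i)
    fold∞-ι = GraphColimit.mediate-leg W∞-colimit _

    fold∞-η : fold∞ ∘ η ≈ f
    fold∞-η = ≈.trans (pullˡ (fold∞-ι 𝟘)) (fold-η (accessible 𝟘))

    fold∞-hom : fold∞ ∘ α ≈ β ∘ F₁ fold∞
    fold∞-hom = GraphColimit.jointly-epic FW∞-colimit λ i →
      let s = acc-inverse (accessible (i ∨ i)) (<-∨ˡ i i) in begin
      (fold∞ ∘ α) ∘ F₁ (ι i)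
        ≈⟨ pullʳ (α-ι i) ⟩
      fold∞ ∘ (ι (i ∨ i) ∘ (α-stage (accessible (i ∨ i)) (<-∨ˡ i i) ∘ F₁ (w (accessible i) s ≼-refl)))
        ≈⟨ pullˡ (fold∞-ι (i ∨ i)) ⟩
      fold (accessible (i ∨ i)) ∘ (α-stage (accessible (i ∨ i)) (<-∨ˡ i i) ∘ F₁ (w (accessible i) s ≼-refl))
        ≈⟨ pullˡ (fold-α (accessible (i ∨ i)) (<-∨ˡ i i)) ⟩
      (β ∘ F₁ (fold s)) ∘ F₁ (w (accessible i) s ≼-refl)
        ≈⟨ pullʳ (F₁-merge (fold-w (accessible i) s ≼-refl)) ⟩
      β ∘ F₁ (fold (accessible i))
        ≈⟨ refl⟩∘⟨ F-resp (fold∞-ι i) ⟨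
      β ∘ F₁ (fold∞ ∘ ι i)
        ≈⟨ pushʳ F-comp ⟩
      (β ∘ F₁ fold∞) ∘ F₁ (ι i)
        ∎
      where open HomReasoning

    fold∞-unique : (h : Hom W∞ B₀) → h ∘ α ≈ β ∘ F₁ h → h ∘ η ≈ f → h ≈ fold∞
    fold∞-unique h h-hom h-η =
      GraphColimit.jointly-epic W∞-colimit λ i → ≈.trans (agrees i) (≈.sym (fold∞-ι i))
      where
      agrees : ∀ i → h ∘ ι i ≈ fold (accessible i)
      agrees = wf _ λ i IH → stage-jointly-epic (accessible i)
        (≈.trans (pullʳ (ι-η-stage i)) (≈.trans h-η (≈.sym (fold-η (accessible i)))))
        λ {j} p → let b = acc-inverse (accessible i) p in begin
          (h ∘ ι i) ∘ α-stage (accessible i) p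
            ≈⟨ pullʳ (ι-α-stage i p) ⟩
          h ∘ (α ∘ F₁ (ι j ∘ w b (accessible j) ≼-refl))
            ≈⟨ pullˡ h-hom ⟩
          (β ∘ F₁ h) ∘ F₁ (ι j ∘ w b (accessible j) ≼-refl)
            ≈⟨ pullʳ (F₁-merge (pullˡ (IH j p))) ⟩
          β ∘ F₁ (fold (accessible j) ∘ w b (accessible j) ≼-refl)
            ≈⟨ refl⟩∘⟨ F-resp (fold-w b (accessible j) ≼-refl) ⟩
          β ∘ F₁ (fold b)
            ≈⟨ fold-α (accessible i) p ⟨
          fold (accessible i) ∘ α-stage (accessible i) p
            ∎
        where open HomReasoning

  freeAlgebra : FreeAlgebra F X
  freeAlgebra = record
    { algebra   = record { carrier = W∞ ; structure = α }
    ; η         = η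
    ; universal = λ B f → let open Universal B f in
        record { hom = fold∞ ; hom-alg = fold∞-hom } ,
        fold∞-η ,
        λ h h-η → fold∞-unique (AlgebraHom.hom h) (AlgebraHom.hom-alg h) h-η
    }

corollary3p9 : (𝒞 : Category) → Cocomplete 𝒞 → (F : Endofunctor 𝒞) →
    (S : Size) → PreservesSizeColimits F S →
    (X : Category.Obj 𝒞) → FreeAlgebra F X
corollary3p9 = FreeAlgebraConstruction.freeAlgebra
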